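{- Let $\Pi_q$ be a projective plane of order $q$ with point set $\mathcal{P}$ and line set $\mathcal{L}$, and let $\mathrm{pma}(\Pi_q)$ denote the number of perfect matchings of the incidence graph of $\Pi_q$. Let $p$ be a prime with $p\nmid \mathrm{pma}(\Pi_q)$, and let $f:\mathcal{L}\to\mathbb{N}$ be any function. Then there exists a set $S\subseteq\mathcal{P}$ such that $|S\cap\ell|\not\equiv f(\ell)\pmod p$ for every line $\ell\in\mathcal{L}$.
   Context: A projective plane of order $q$ has $q^2+q+1$ points and $q^2+q+1$ lines, each line has $q+1$ points, each point lies on $q+1$ lines, two points lie on a unique line and two lines meet in a unique point. The incidence graph (Levi graph) of $\Pi_q$ is the bipartite graph whose vertex classes are $\mathcal{P}$ and $\mathcal{L}$, with a point adjacent to a line iff they are incident. Lines are identified with their point sets. -}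

module Defs where

open import Data.Nat using (ℕ; zero; suc; _+_; _*_)
open import Data.Fin using (Fin; zero; suc)
open import Data.Bool using (Bool; true; false; _∧_)
open import Data.List using (List; []; _∷_; map; concatMap; allFin; filter; length)
open import Data.Product using (Σ; _×_; _,_; ∃)
open import Relation.Binary.PropositionalEquality using (_≡_; _≢_)
open import Relation.Nullary using (Dec; ¬_)
open import Relation.Unary using (Decidable)
open import Function.Definitions using (Injective)

numPts : ℕ → ℕ
numPts q = q * q + q + 1

countFin : (n : ℕ) → (Fin n → Bool) → ℕ
countFin n P = length (filter (λ x → Data.Bool._≟_ (P x) true) (allFin n))

record ProjectivePlane (q : ℕ) : Set where
  field
    I : Fin (numPts q) → Fin (numPts q) → Bool
    linePts : ∀ l → countFin (numPts q) (λ p → I p l) ≡ suc q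
    ptLines : ∀ p → countFin (numPts q) (λ l → I p l) ≡ suc q
    twoPts : ∀ p₁ p₂ → p₁ ≢ p₂ →
      Σ (Fin (numPts q)) λ l → (I p₁ l ≡ true × I p₂ l ≡ true) ×
        (∀ l' → I p₁ l' ≡ true → I p₂ l' ≡ true → l' ≡ l)
    twoLines : ∀ l₁ l₂ → l₁ ≢ l₂ →
      Σ (Fin (numPts q)) λ p → (I p l₁ ≡ true × I p l₂ ≡ true) ×
        (∀ p' → I p' l₁ ≡ true → I p' l₂ ≡ true → p' ≡ p)

allFuns : (k n : ℕ) → List (Fin k → Fin n)
allFuns zero n = (λ ()) ∷ []
allFuns (suc k) n =
  concatMap (λ a → map (λ g → λ { zero → a ; (suc i) → g i }) (allFuns k n)) (allFin n)

open Data.Bool using (not)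
open import Data.Fin using (_≟_)
open import Relation.Nullary.Decidable using (⌊_⌋)
open import Data.Bool.ListAction using (all)

injB : {k n : ℕ} → (Fin k → Fin n) → Bool
injB {k} σ = all (λ i → all (λ j → ⌊ i ≟ j ⌋ Data.Bool.∨ not ⌊ σ i ≟ σ j ⌋) (allFin k)) (allFin k)

-- A perfect matching of the incidence graph (bipartite, both sides of size n)
-- is the same as a bijection σ : points → lines with every p incident to σ p.
-- pma = number of such σ (injective maps between equal finite sets are bijections).
pma : {q : ℕ} → ProjectivePlane q → ℕ
pma {q} Π = length (filter (λ σ → Data.Bool._≟_ (injB σ ∧ all (λ p → I p (σ p)) (allFin n)) true)
                           (allFuns n n))
  where
    open ProjectivePlane Π
    n = numPts q

interSize : {q : ℕ} → ProjectivePlane q → (Fin (numPts q) → Bool) → Fin (numPts q) → ℕ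
interSize {q} Π S l = countFin (numPts q) (λ p → S p ∧ ProjectivePlane.I Π p l)

-- Attach to a set S ⊆ 𝒫 (a 0/1-vector x) the integer Φ(x) = ∏ₗ (|S ∩ ℓ| − f(ℓ) mod p),
-- a product of n = |𝓛| linear forms in the n variables x. The mixed finite difference
-- Δ Φ = ∑ₓ (−1)^(n − |x|) Φ(x) kills every monomial of degree < n, so it is the coefficient
-- of x₁⋯xₙ in Φ: the permanent of the incidence matrix, i.e. pma(Π). If p divided every
-- Φ(x) it would divide pma(Π).
module Submission where

open import Defs
open import Data.Nat using (ℕ; _%_)
open import Data.Nat.Divisibility using (_∣_)
open import Data.Nat.Primality using (Prime)
open import Data.Fin using (Fin)
open import Data.Bool using (Bool)
open import Data.Product using (Σ)
open import Relation.Nullary using (¬_)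
open import Relation.Binary.PropositionalEquality using (_≡_)

open import Data.Bool using (true; false; _∧_; _∨_; not; if_then_else_)
import Data.Bool.Properties as 𝔹
open import Data.Bool.ListAction using (and; all)
open import Data.Empty using (⊥-elim)
open import Data.Fin using (zero; suc; _≟_)
open import Data.Fin.Properties using (suc-injective)
open import Data.Integer using (ℤ; +_; _+_; _-_; _*_; -_; 0ℤ; 1ℤ)
import Data.Integer.Properties as ℤ
open import Data.Integer.Divisibility.Signed
  using (divides; _∣?_; ∣m∣n⇒∣m-n; ∣m⇒∣m*n; ∣n⇒∣m*n; ∣⇒∣ᵤ)
  renaming (_∣_ to _∣ℤ_)
open import Data.Integer.Tactic.RingSolver using (solve-∀)
open import Data.List as List
  using (List; []; [_]; _++_; map; concat; concatMap; filter; length; allFin; tabulate)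
open import Data.List.Properties
  using (filter-++; length-++; filter-≐; map-tabulate; map-cong; concatMap-pure)
open import Data.Nat as ℕ using (zero; suc; _≤_; _/_; NonZero)
open import Data.Nat.Properties using (+-suc; ≤-reflexive; n≤0⇒n≡0)
open import Data.Nat.DivMod using (m≡m%n+[m/n]*n)
open import Data.Product using (_,_; ∃)
open import Data.Sum using (_⊎_; inj₁; inj₂)
open import Data.Vec.Functional using (_∷_)
open import Function using (_∘_; mk⇔)
open import Relation.Nullary using (yes; no; does)
open import Relation.Nullary.Decidable using (⌊_⌋; does-⇔; isYes≗does; ⌊⌋-map′)
open import Relation.Binary.PropositionalEquality
  using (refl; sym; trans; cong; cong₂; subst; module ≡-Reasoning)

open import Algebra.Properties.Semiring.Sum ℤ.+-*-semiring
  using (sum-syntax; sum-cong-≗; *-distribˡ-sum)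
open import Algebra.Properties.Monoid.Sum ℤ.*-1-monoid
  using () renaming (sum to product; sum-cong-≗ to product-cong)
open import Algebra.Properties.CommutativeSemigroup ℤ.*-commutativeSemigroup
  using (x∙yz≈y∙xz)
open import Algebra.Solver.IdempotentCommutativeMonoid 𝔹.∧-idempotentCommutativeMonoid
  using (solve; _⊜_; _⊕_)

indicator : Bool → ℤ
indicator true  = 1ℤ
indicator false = 0ℤ

Δ : ∀ k → ((Fin k → Bool) → ℤ) → ℤ
Δ zero    F = F (λ ())
Δ (suc k) F = Δ k (F ∘ (true ∷_)) - Δ k (F ∘ (false ∷_))

Δ-cong : ∀ k {F G : (Fin k → Bool) → ℤ} → (∀ x → F x ≡ G x) → Δ k F ≡ Δ k G
Δ-cong zero    F≗G = F≗G _
Δ-cong (suc k) F≗G = cong₂ _-_ (Δ-cong k (F≗G ∘ (true ∷_))) (Δ-cong k (F≗G ∘ (false ∷_)))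

Δ-0 : ∀ k → Δ k (λ _ → 0ℤ) ≡ 0ℤ
Δ-0 zero    = refl
Δ-0 (suc k) = cong₂ _-_ (Δ-0 k) (Δ-0 k)

Δ-homo₂ : ∀ (_⊙_ : ℤ → ℤ → ℤ) → (∀ a b c d → (a ⊙ b) - (c ⊙ d) ≡ (a - c) ⊙ (b - d)) →
          ∀ k (F G : (Fin k → Bool) → ℤ) → Δ k (λ x → F x ⊙ G x) ≡ Δ k F ⊙ Δ k G
Δ-homo₂ _⊙_ interchange zero    F G = refl
Δ-homo₂ _⊙_ interchange (suc k) F G = trans
  (cong₂ _-_ (Δ-homo₂ _⊙_ interchange k (F ∘ (true ∷_)) (G ∘ (true ∷_)))
             (Δ-homo₂ _⊙_ interchange k (F ∘ (false ∷_)) (G ∘ (false ∷_))))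
  (interchange _ _ _ _)

Δ-distrib-+ : ∀ k (F G : (Fin k → Bool) → ℤ) → Δ k (λ x → F x + G x) ≡ Δ k F + Δ k G
Δ-distrib-+ = Δ-homo₂ _+_ regroup
  where
  regroup : ∀ a b c d → (a + b) - (c + d) ≡ (a - c) + (b - d)
  regroup = solve-∀

Δ-distrib-- : ∀ k (F G : (Fin k → Bool) → ℤ) → Δ k (λ x → F x - G x) ≡ Δ k F - Δ k G
Δ-distrib-- = Δ-homo₂ _-_ regroup
  where
  regroup : ∀ a b c d → (a - b) - (c - d) ≡ (a - c) - (b - d)
  regroup = solve-∀

Δ-*ˡ : ∀ k c (F : (Fin k → Bool) → ℤ) → Δ k (λ x → c * F x) ≡ c * Δ k F
Δ-*ˡ zero    c F = refl
Δ-*ˡ (suc k) c F = trans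
  (cong₂ _-_ (Δ-*ˡ k c (F ∘ (true ∷_))) (Δ-*ˡ k c (F ∘ (false ∷_))))
  (factor c (Δ k (F ∘ (true ∷_))) (Δ k (F ∘ (false ∷_))))
  where
  factor : ∀ c a b → c * a - c * b ≡ c * (a - b)
  factor = solve-∀

Δ-∑ : ∀ k {N} (H : Fin N → (Fin k → Bool) → ℤ) →
      Δ k (λ x → ∑[ j < N ] H j x) ≡ ∑[ j < N ] Δ k (H j)
Δ-∑ k {zero}  H = Δ-0 k
Δ-∑ k {suc N} H =
  trans (Δ-distrib-+ k (H zero) _) (cong (_+_ (Δ k (H zero))) (Δ-∑ k (H ∘ suc)))

indivisibleValue⊎∣Δ : ∀ d k (F : (Fin k → Bool) → ℤ) →
                      (∃ λ x → ¬ d ∣ℤ F x) ⊎ d ∣ℤ Δ k F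
indivisibleValue⊎∣Δ d zero F with d ∣? F (λ ())
... | yes d∣F = inj₂ d∣F
... | no  d∤F = inj₁ ((λ ()) , d∤F)
indivisibleValue⊎∣Δ d (suc k) F
  with indivisibleValue⊎∣Δ d k (λ x → F (true ∷ x))
     | indivisibleValue⊎∣Δ d k (λ x → F (false ∷ x))
... | inj₁ (x , d∤) | _             = inj₁ (true ∷ x , d∤)
... | inj₂ _        | inj₁ (x , d∤) = inj₁ (false ∷ x , d∤)
... | inj₂ d∣₁      | inj₂ d∣₀      = inj₂ (∣m∣n⇒∣m-n d∣₁ d∣₀)

∣-product : ∀ {N} d (h : Fin N → ℤ) l → d ∣ℤ h l → d ∣ℤ product h
∣-product {suc N} d h zero    d∣hl = ∣m⇒∣m*n (product (h ∘ suc)) d∣hl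
∣-product {suc N} d h (suc l) d∣hl = ∣n⇒∣m*n (h zero) (∣-product d (h ∘ suc) l d∣hl)

_<ᵇ_ : ∀ {N} → Fin N → Fin N → Bool
_     <ᵇ zero  = false
zero  <ᵇ suc _ = true
suc l <ᵇ suc j = l <ᵇ j

-- does, unlike ⌊_⌋, computes on suc l ≟ suc j; productOn-telescope relies on it.
delete : ∀ {N} → Fin N → (Fin N → Bool) → Fin N → Bool
delete j U l = not (does (l ≟ j)) ∧ U l

productOn : ∀ {N} → (Fin N → Bool) → (Fin N → ℤ) → ℤ
productOn U h = product (λ l → if U l then h l else 1ℤ)

productOn-telescope : ∀ {N} (U : Fin N → Bool) (w : Bool → Fin N → ℤ) →
  productOn U (w true) - productOn U (w false) ≡
  ∑[ j < N ] ((if U j then w true j - w false j else 0ℤ) *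
              productOn (delete j U) (λ l → w (l <ᵇ j) l))
productOn-telescope {zero}  U w = refl
productOn-telescope {suc N} U w = begin
    u₀ * ∏u - v₀ * ∏v
  ≡⟨ split (U zero) (w true zero) (w false zero) ∏u ∏v ⟩
    c₀ * ∏v + u₀ * (∏u - ∏v)
  ≡⟨ cong₂ _+_ (cong (c₀ *_) (sym (ℤ.*-identityˡ ∏v)))
               (cong (u₀ *_) (productOn-telescope (U ∘ suc) (λ b → w b ∘ suc))) ⟩
    c₀ * (1ℤ * ∏v) + u₀ * ∑[ j < N ] (c (suc j) * Q j)
  ≡⟨ cong (_+_ (c₀ * (1ℤ * ∏v)))
          (trans (*-distribˡ-sum u₀ (λ j → c (suc j) * Q j))
                 (sum-cong-≗ λ j → x∙yz≈y∙xz u₀ (c (suc j)) (Q j))) ⟩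
    c₀ * (1ℤ * ∏v) + ∑[ j < N ] (c (suc j) * (u₀ * Q j))
  ∎
  -- The last line is the right-hand side computed: deleting index 0 leaves 1ℤ * ∏v,
  -- deleting index suc j leaves the factor u₀ in front of Q j.
  where
  open ≡-Reasoning
  u₀ v₀ c₀ ∏u ∏v : ℤ
  u₀ = if U zero then w true zero else 1ℤ
  v₀ = if U zero then w false zero else 1ℤ
  c₀ = if U zero then w true zero - w false zero else 0ℤ
  ∏u = productOn (U ∘ suc) (w true ∘ suc)
  ∏v = productOn (U ∘ suc) (w false ∘ suc)
  c : Fin (suc N) → ℤ
  c j = if U j then w true j - w false j else 0ℤ
  Q : Fin N → ℤ
  Q j = productOn (delete j (U ∘ suc)) (λ l → w (l <ᵇ j) (suc l))
  split : ∀ b (u v X Y : ℤ) →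
          (if b then u else 1ℤ) * X - (if b then v else 1ℤ) * Y ≡
          (if b then u - v else 0ℤ) * Y + (if b then u else 1ℤ) * (X - Y)
  split true      = distrib
    where
    distrib : ∀ u v X Y → u * X - v * Y ≡ (u - v) * Y + u * (X - Y)
    distrib = solve-∀
  split false _ _ = unit
    where
    unit : ∀ X Y → 1ℤ * X - 1ℤ * Y ≡ 0ℤ * Y + 1ℤ * (X - Y)
    unit = solve-∀

size : ∀ {N} → (Fin N → Bool) → ℕ
size {zero}  U = 0
size {suc N} U = (if U zero then 1 else 0) ℕ.+ size (U ∘ suc)

size-true : ∀ N → size {N} (λ _ → true) ≡ N
size-true zero    = refl
size-true (suc N) = cong suc (size-true N)

size-delete : ∀ {N} (U : Fin N → Bool) j → U j ≡ true → size U ≡ suc (size (delete j U))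
size-delete U zero    Uj≡true rewrite Uj≡true = refl
size-delete U (suc j) Uj≡true =
  trans (cong ((if U zero then 1 else 0) ℕ.+_) (size-delete (U ∘ suc) j Uj≡true))
        (+-suc _ _)

productOn-size≡0 : ∀ {N} (U : Fin N → Bool) h → size U ≡ 0 → productOn U h ≡ 1ℤ
productOn-size≡0 {zero}  U h _ = refl
productOn-size≡0 {suc N} U h size≡0 with U zero
productOn-size≡0 {suc N} U h () | true
productOn-size≡0 {suc N} U h size≡0 | false =
  trans (ℤ.*-identityˡ _) (productOn-size≡0 (U ∘ suc) (h ∘ suc) size≡0)

linearForm : ∀ {k N} → (Fin k → Fin N → Bool) → (Fin N → ℤ) → Fin N → (Fin k → Bool) → ℤ
linearForm {k} A g l x = ∑[ i < k ] indicator (x i ∧ A i l) + g l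

linearForm-∷ : ∀ {k N} (A : Fin (suc k) → Fin N → Bool) g l b x →
  linearForm A g l (b ∷ x) ≡
  linearForm (A ∘ suc) (λ l → g l + indicator (b ∧ A zero l)) l x
linearForm-∷ A g l b x = regroup (indicator (b ∧ A zero l)) _ (g l)
  where
  regroup : ∀ a s c → (a + s) + c ≡ s + (c + a)
  regroup = solve-∀

permanent : ∀ {N} k → (Fin k → Fin N → Bool) → ℤ
permanent     zero    R = 1ℤ
permanent {N} (suc k) R =
  ∑[ a < N ] (if R zero a then permanent k (λ i → delete a (R (suc i))) else 0ℤ)

permanent-cong : ∀ {N} k {R S : Fin k → Fin N → Bool} →
                 (∀ i l → R i l ≡ S i l) → permanent k R ≡ permanent k S
permanent-cong zero    R≗S = refl
permanent-cong (suc k) R≗S = sum-cong-≗ λ a →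
  cong₂ (λ r p → if r then p else 0ℤ) (R≗S zero a)
        (permanent-cong k λ i l → cong (not (does (l ≟ a)) ∧_) (R≗S (suc i) l))

Δ-productOn-linearForm : ∀ {N} k (A : Fin k → Fin N → Bool) (U : Fin N → Bool) (g : Fin N → ℤ) →
  size U ≤ k →
  Δ k (λ x → productOn U (λ l → linearForm A g l x)) ≡ permanent k (λ i l → U l ∧ A i l)
Δ-productOn-linearForm zero    A U g size≤0 = productOn-size≡0 U _ (n≤0⇒n≡0 size≤0)
Δ-productOn-linearForm {N} (suc k) A U g size≤1+k = begin
    Δ k (Φ ∘ (true ∷_)) - Δ k (Φ ∘ (false ∷_))
  ≡⟨ sym (Δ-distrib-- k (Φ ∘ (true ∷_)) (Φ ∘ (false ∷_))) ⟩
    Δ k (λ x → Φ (true ∷ x) - Φ (false ∷ x))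
  ≡⟨ Δ-cong k difference ⟩
    Δ k (λ x → ∑[ j < N ] (c j * Ψ j x))
  ≡⟨ Δ-∑ k (λ j x → c j * Ψ j x) ⟩
    ∑[ j < N ] Δ k (λ x → c j * Ψ j x)
  ≡⟨ sum-cong-≗ (λ j → Δ-*ˡ k (c j) (Ψ j)) ⟩
    ∑[ j < N ] (c j * Δ k (Ψ j))
  ≡⟨ sum-cong-≗ expand ⟩
    permanent (suc k) (λ i l → U l ∧ A i l)
  ∎
  where
  open ≡-Reasoning
  Φ : (Fin (suc k) → Bool) → ℤ
  Φ x = productOn U (λ l → linearForm A g l x)
  c : Fin N → ℤ
  c j = if U j then indicator (A zero j) else 0ℤ
  -- In the j-th telescoped product the factors l < j carry x₀ = 1, the others x₀ = 0.
  shift : Fin N → Fin N → ℤ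
  shift j l = g l + indicator (l <ᵇ j ∧ A zero l)
  Ψ : Fin N → (Fin k → Bool) → ℤ
  Ψ j x = productOn (delete j U) (λ l → linearForm (A ∘ suc) (shift j) l x)

  difference : ∀ x → Φ (true ∷ x) - Φ (false ∷ x) ≡ ∑[ j < N ] (c j * Ψ j x)
  difference x = trans (productOn-telescope U (λ b l → linearForm A g l (b ∷ x)))
    (sum-cong-≗ λ j → cong₂ _*_
      (𝔹.if-cong-then (U j) (cancel (indicator (A zero j)) _ (g j)))
      (product-cong λ l → 𝔹.if-cong-then (delete j U l) (linearForm-∷ A g l (l <ᵇ j) x)))
    where
    cancel : ∀ a s c → (a + s + c) - (0ℤ + s + c) ≡ a
    cancel = solve-∀

  expand : ∀ j → (if U j then indicator (A zero j) else 0ℤ) * Δ k (Ψ j) ≡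
           (if U j ∧ A zero j then permanent k (λ i → delete j (λ l → U l ∧ A (suc i) l)) else 0ℤ)
  expand j with U j in Uj≡true | A zero j
  ... | false | _     = ℤ.*-zeroˡ (Δ k (Ψ j))
  ... | true  | false = ℤ.*-zeroˡ (Δ k (Ψ j))
  ... | true  | true  = begin
      1ℤ * Δ k (Ψ j)
    ≡⟨ ℤ.*-identityˡ _ ⟩
      Δ k (Ψ j)
    ≡⟨ Δ-productOn-linearForm k (A ∘ suc) (delete j U) (shift j) size-bound ⟩
      permanent k (λ i l → delete j U l ∧ A (suc i) l)
    ≡⟨ permanent-cong k (λ i l → 𝔹.∧-assoc (not (does (l ≟ j))) (U l) (A (suc i) l)) ⟩
      permanent k (λ i → delete j (λ l → U l ∧ A (suc i) l))
    ∎
    where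
    size-bound : size (delete j U) ≤ k
    size-bound = ℕ.s≤s⁻¹ (subst (_≤ suc k) (size-delete U j Uj≡true) size≤1+k)

-- countFin, interSize and pma of Defs are all instances of count.
count : ∀ {A : Set} → (A → Bool) → List A → ℕ
count P xs = length (filter (λ x → P x 𝔹.≟ true) xs)

count-++ : ∀ {A : Set} (P : A → Bool) xs ys → count P (xs ++ ys) ≡ count P xs ℕ.+ count P ys
count-++ P xs ys =
  trans (cong length (filter-++ (λ x → P x 𝔹.≟ true) xs ys))
        (length-++ (filter (λ x → P x 𝔹.≟ true) xs))

count-map : ∀ {A B : Set} (P : B → Bool) (f : A → B) xs → count P (map f xs) ≡ count (P ∘ f) xs
count-map P f []            = refl
count-map P f (x List.∷ xs) with P (f x)
... | true  = cong suc (count-map P f xs)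
... | false = count-map P f xs

count-cong : ∀ {A : Set} {P Q : A → Bool} → (∀ x → P x ≡ Q x) → ∀ xs → count P xs ≡ count Q xs
count-cong {P = P} {Q} P≗Q xs = cong length
  (filter-≐ (λ x → P x 𝔹.≟ true) (λ x → Q x 𝔹.≟ true)
            ((λ {x} → trans (sym (P≗Q x))) , (λ {x} → trans (P≗Q x))) xs)

count-∧ : ∀ {A : Set} b (P : A → Bool) xs →
          count (λ x → b ∧ P x) xs ≡ (if b then count P xs else 0)
count-∧ true  P xs            = refl
count-∧ false P []            = refl
count-∧ false P (x List.∷ xs) = count-∧ false P xs

+count-concatMap-allFin : ∀ {A : Set} {N} (P : A → Bool) (h : Fin N → List A) →
                          + count P (concatMap h (allFin N)) ≡ ∑[ a < N ] (+ count P (h a))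
+count-concatMap-allFin P h =
  trans (cong (+_ ∘ count P ∘ concat) (map-tabulate (λ a → a) h)) (concat-tabulate h)
  where
  concat-tabulate : ∀ {N} (h : Fin N → List _) →
                    + count P (concat (tabulate h)) ≡ ∑[ a < N ] (+ count P (h a))
  concat-tabulate {zero}  h = refl
  concat-tabulate {suc N} h =
    trans (cong +_ (count-++ P (h zero) _))
          (trans (ℤ.pos-+ (count P (h zero)) _)
                 (cong (_+_ (+ count P (h zero))) (concat-tabulate (h ∘ suc))))

+count-allFin : ∀ {N} (P : Fin N → Bool) → + count P (allFin N) ≡ ∑[ i < N ] indicator (P i)
+count-allFin {N} P =
  trans (cong (+_ ∘ count P) (sym (concatMap-pure (allFin N))))
        (trans (+count-concatMap-allFin P [_]) (sum-cong-≗ singleton))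
  where
  singleton : ∀ i → + count P [ i ] ≡ indicator (P i)
  singleton i with P i
  ... | true  = refl
  ... | false = refl

all-cong : ∀ {A : Set} {p q : A → Bool} → (∀ x → p x ≡ q x) → ∀ xs → all p xs ≡ all q xs
all-cong p≗q xs = cong and (map-cong p≗q xs)

all-∧ : ∀ {A : Set} (p q : A → Bool) xs → all (λ x → p x ∧ q x) xs ≡ all p xs ∧ all q xs
all-∧ p q []            = refl
all-∧ p q (x List.∷ xs) =
  trans (cong (_∧_ (p x ∧ q x)) (all-∧ p q xs)) (interchange (p x) (q x) _ _)
  where
  interchange : ∀ a b c d → (a ∧ b) ∧ (c ∧ d) ≡ (a ∧ c) ∧ (b ∧ d)
  interchange = solve 4 (λ a b c d → (a ⊕ b) ⊕ (c ⊕ d) ⊜ (a ⊕ c) ⊕ (b ⊕ d)) refl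

all-allFin-suc : ∀ {k} (P : Fin (suc k) → Bool) →
                 all P (allFin (suc k)) ≡ P zero ∧ all (P ∘ suc) (allFin k)
all-allFin-suc P = cong (P zero ∧_)
  (trans (cong and (map-tabulate suc P)) (sym (cong and (map-tabulate (λ i → i) (P ∘ suc)))))

isMatching : ∀ {k N} → (Fin k → Fin N → Bool) → (Fin k → Fin N) → Bool
isMatching {k} R σ = injB σ ∧ all (λ i → R i (σ i)) (allFin k)

head∉tail : ∀ {k N} → (Fin (suc k) → Fin N) → Bool
head∉tail {k} σ = all (λ i → not (does (σ (suc i) ≟ σ zero))) (allFin k)

-- head∉tail σ enters twice: from the row and from the column of index zero.
injB-suc : ∀ {k N} (σ : Fin (suc k) → Fin N) →
           injB σ ≡ head∉tail σ ∧ (head∉tail σ ∧ injB (σ ∘ suc))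
injB-suc {k} {N} σ = begin
    all (row σ) (allFin (suc k))
  ≡⟨ all-allFin-suc (row σ) ⟩
    row σ zero ∧ all (row σ ∘ suc) (allFin k)
  ≡⟨ cong₂ _∧_ first-row (all-cong later-row (allFin k)) ⟩
    head∉tail σ ∧ all (λ i → not (does (σ (suc i) ≟ σ zero)) ∧ row (σ ∘ suc) i) (allFin k)
  ≡⟨ cong (head∉tail σ ∧_) (all-∧ _ _ (allFin k)) ⟩
    head∉tail σ ∧ (head∉tail σ ∧ injB (σ ∘ suc))
  ∎
  where
  open ≡-Reasoning
  entry : ∀ {m} → (Fin m → Fin N) → Fin m → Fin m → Bool
  entry τ i j = ⌊ i ≟ j ⌋ ∨ not ⌊ τ i ≟ τ j ⌋
  row : ∀ {m} → (Fin m → Fin N) → Fin m → Bool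
  row {m} τ i = all (entry τ i) (allFin m)
  first-row : row σ zero ≡ head∉tail σ
  first-row = trans (all-allFin-suc (entry σ zero)) (all-cong (λ j → cong not
    (trans (isYes≗does (σ zero ≟ σ (suc j)))
           (does-⇔ (mk⇔ sym sym) (σ zero ≟ σ (suc j)) (σ (suc j) ≟ σ zero))))
    (allFin k))
  later-row : ∀ i → row σ (suc i) ≡ not (does (σ (suc i) ≟ σ zero)) ∧ row (σ ∘ suc) i
  later-row i = trans (all-allFin-suc (entry σ (suc i)))
    (cong₂ _∧_ (cong not (isYes≗does (σ (suc i) ≟ σ zero)))
               (all-cong (λ j → cong (_∨ not ⌊ σ (suc i) ≟ σ (suc j) ⌋)
                                     (⌊⌋-map′ (cong suc) suc-injective (i ≟ j)))
                         (allFin k)))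

isMatching-suc : ∀ {k N} (R : Fin (suc k) → Fin N → Bool) (σ : Fin (suc k) → Fin N) →
  isMatching R σ ≡ R zero (σ zero) ∧ isMatching (λ i → delete (σ zero) (R (suc i))) (σ ∘ suc)
isMatching-suc {k} R σ = begin
    injB σ ∧ all (λ i → R i (σ i)) (allFin (suc k))
  ≡⟨ cong₂ _∧_ (injB-suc σ) (all-allFin-suc (λ i → R i (σ i))) ⟩
    (head∉tail σ ∧ (head∉tail σ ∧ injB (σ ∘ suc))) ∧ (R zero (σ zero) ∧ all R′ (allFin k))
  ≡⟨ rearrange (head∉tail σ) (injB (σ ∘ suc)) (R zero (σ zero)) (all R′ (allFin k)) ⟩
    R zero (σ zero) ∧ (injB (σ ∘ suc) ∧ (head∉tail σ ∧ all R′ (allFin k)))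
  ≡⟨ cong (λ b → R zero (σ zero) ∧ (injB (σ ∘ suc) ∧ b)) (sym (all-∧ _ R′ (allFin k))) ⟩
    R zero (σ zero) ∧ isMatching (λ i → delete (σ zero) (R (suc i))) (σ ∘ suc)
  ∎
  where
  open ≡-Reasoning
  R′ : Fin k → Bool
  R′ i = R (suc i) (σ (suc i))
  rearrange : ∀ n j r s → (n ∧ (n ∧ j)) ∧ (r ∧ s) ≡ r ∧ (j ∧ (n ∧ s))
  rearrange = solve 4 (λ n j r s → (n ⊕ (n ⊕ j)) ⊕ (r ⊕ s) ⊜ r ⊕ (j ⊕ (n ⊕ s))) refl

count-matchings : ∀ {N} k (R : Fin k → Fin N → Bool) →
                  + count (isMatching R) (allFuns k N) ≡ permanent k R
count-matchings     zero    R = refl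
count-matchings {N} (suc k) R =
  trans (+count-concatMap-allFin {N = N} (isMatching R) _)
        (sum-cong-≗ λ a → first-value a _ (λ τ → isMatching-suc R _))
  where
  first-value : ∀ a (extend : (Fin k → Fin N) → Fin (suc k) → Fin N) →
    (∀ τ → isMatching R (extend τ) ≡ R zero a ∧ isMatching (λ i → delete a (R (suc i))) τ) →
    + count (isMatching R) (map extend (allFuns k N)) ≡
    (if R zero a then permanent k (λ i → delete a (R (suc i))) else 0ℤ)
  first-value a extend matching-extend = begin
      + count (isMatching R) (map extend (allFuns k N))
    ≡⟨ cong +_ (count-map (isMatching R) extend (allFuns k N)) ⟩
      + count (isMatching R ∘ extend) (allFuns k N)
    ≡⟨ cong +_ (count-cong matching-extend (allFuns k N)) ⟩
      + count (λ τ → R zero a ∧ isMatching R′ τ) (allFuns k N)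
    ≡⟨ cong +_ (count-∧ (R zero a) (isMatching R′) (allFuns k N)) ⟩
      + (if R zero a then count (isMatching R′) (allFuns k N) else 0)
    ≡⟨ 𝔹.if-float +_ (R zero a) ⟩
      (if R zero a then + count (isMatching R′) (allFuns k N) else 0ℤ)
    ≡⟨ 𝔹.if-cong-then (R zero a) (count-matchings k R′) ⟩
      (if R zero a then permanent k R′ else 0ℤ)
    ∎
    where
    open ≡-Reasoning
    R′ : Fin k → Fin N → Bool
    R′ i = delete a (R (suc i))

m%d≡n%d⇒d∣m-n%d : ∀ {m n d} .{{_ : NonZero d}} → m % d ≡ n % d → + d ∣ℤ + m - + (n % d)
m%d≡n%d⇒d∣m-n%d {m} {n} {d} m%d≡n%d rewrite sym m%d≡n%d = divides (+ (m / d)) (begin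
    + m - + (m % d)
  ≡⟨ cong (λ z → + z - + (m % d)) (m≡m%n+[m/n]*n m d) ⟩
    + (m % d ℕ.+ m / d ℕ.* d) - + (m % d)
  ≡⟨ cong (_- + (m % d)) (trans (ℤ.pos-+ (m % d) _)
                                (cong (_+_ (+ (m % d))) (ℤ.pos-* (m / d) d))) ⟩
    + (m % d) + + (m / d) * + d - + (m % d)
  ≡⟨ cancel (+ (m % d)) (+ (m / d) * + d) ⟩
    + (m / d) * + d
  ∎)
  where
  open ≡-Reasoning
  cancel : ∀ a b → a + b - a ≡ b
  cancel = solve-∀

mainTheorem3 : (q : ℕ) (Π : ProjectivePlane q) (p : ℕ) .{{_ : Data.Nat.NonZero p}} →
    Prime p → ¬ (p ∣ pma Π) → (f : Fin (numPts q) → ℕ) →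
    Σ (Fin (numPts q) → Bool) λ S →
      ∀ l → ¬ (interSize Π S l % p ≡ f l % p)
mainTheorem3 q Π p _ p∤pma f = conclude (indivisibleValue⊎∣Δ (+ p) n Φ)
  where
  open ProjectivePlane Π
  n : ℕ
  n = numPts q
  factor : Fin n → (Fin n → Bool) → ℤ
  factor = linearForm I (λ l → - + (f l % p))
  Φ : (Fin n → Bool) → ℤ
  Φ S = product (λ l → factor l S)

  ΔΦ≡pma : Δ n Φ ≡ + pma Π
  ΔΦ≡pma = trans (Δ-productOn-linearForm n I (λ _ → true) _ (≤-reflexive (size-true n)))
                 (sym (count-matchings n I))

  p∣factor : ∀ S l → interSize Π S l % p ≡ f l % p → + p ∣ℤ factor l S
  p∣factor S l S∩l≡f = subst (λ s → + p ∣ℤ s - + (f l % p))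
                             (+count-allFin (λ i → S i ∧ I i l)) (m%d≡n%d⇒d∣m-n%d S∩l≡f)

  conclude : (∃ λ S → ¬ + p ∣ℤ Φ S) ⊎ + p ∣ℤ Δ n Φ →
             Σ (Fin n → Bool) λ S → ∀ l → ¬ (interSize Π S l % p ≡ f l % p)
  conclude (inj₁ (S , p∤ΦS)) = S , λ l S∩l≡f → p∤ΦS (∣-product (+ p) _ l (p∣factor S l S∩l≡f))
  conclude (inj₂ p∣ΔΦ)       = ⊥-elim (p∤pma (∣⇒∣ᵤ (subst (+ p ∣ℤ_) ΔΦ≡pma p∣ΔΦ)))
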